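{- Let $G$ be a connected graph of order $n\geq 3$ and $M(G)$ its middle graph. Then $Aut(G)\cong Aut(M(G))$ as groups.
   Context: All graphs are simple, finite, undirected. The middle graph $M(G)$ has vertex set $V(G)\cup E(G)$; $v\in V(G)$ is adjacent to $e\in E(G)$ iff $v$ is an endpoint of $e$, two elements $e,e'\in E(G)$ are adjacent iff they share an endpoint in $G$, and no two elements of $V(G)$ are adjacent. -}

module Defs where

open import Level using (0ℓ)
open import Data.Bool using (Bool; true; false; T)
open import Data.Nat using (ℕ)
open import Data.Fin using (Fin; _<_)
open import Data.Empty using (⊥)
open import Data.Product using (Σ; Σ-syntax; ∃; ∃-syntax; _×_; _,_; proj₁; proj₂)
open import Data.Sum using (_⊎_; inj₁; inj₂)
open import Relation.Nullary using (¬_)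
open import Relation.Binary.PropositionalEquality using (_≡_; refl; sym; trans; subst; cong)
open import Function using (_∘_)
open import Function.Bundles using (_↔_; Inverse; _⇔_; Equivalence; mk⇔)
open import Function.Construct.Composition using (_↔-∘_)
open import Function.Construct.Identity using (↔-id)
open import Function.Construct.Symmetry using (↔-sym)
open import Algebra.Bundles.Raw using (RawGroup)

record SimpleGraph (n : ℕ) : Set where
  field
    adj   : Fin n → Fin n → Bool
    adj-sym : ∀ u v → adj u v ≡ adj v u
    adj-irrefl : ∀ u → adj u u ≡ false

open SimpleGraph public

Adj : ∀ {n} → SimpleGraph n → Fin n → Fin n → Set
Adj G u v = T (adj G u v)

data Reach {n} (G : SimpleGraph n) : Fin n → Fin n → Set where
  here : ∀ {u} → Reach G u u
  step : ∀ {u w v} → Adj G u w → Reach G w v → Reach G u v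

Connected : ∀ {n} → SimpleGraph n → Set
Connected {n} G = ∀ (u v : Fin n) → Reach G u v

-- Edges of G: unordered pairs {u,v}, represented uniquely as (u , v) with u < v.
Edge : ∀ {n} → SimpleGraph n → Set
Edge {n} G = Σ[ u ∈ Fin n ] Σ[ v ∈ Fin n ] (u < v × Adj G u v)

Incident : ∀ {n} (G : SimpleGraph n) → Fin n → Edge G → Set
Incident G w (u , v , _) = (w ≡ u) ⊎ (w ≡ v)

MVertex : ∀ {n} → SimpleGraph n → Set
MVertex {n} G = Fin n ⊎ Edge G

MAdj : ∀ {n} (G : SimpleGraph n) → MVertex G → MVertex G → Set
MAdj G (inj₁ v) (inj₁ w) = ⊥
MAdj G (inj₁ v) (inj₂ e) = Incident G v e
MAdj G (inj₂ e) (inj₁ v) = Incident G v e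
MAdj G (inj₂ e) (inj₂ f) = ¬ (e ≡ f) × (∃[ w ] (Incident G w e × Incident G w f))

Aut : (V : Set) → (V → V → Set) → Set
Aut V R = Σ[ σ ∈ V ↔ V ] (∀ u v → R u v ⇔ R (Inverse.to σ u) (Inverse.to σ v))

module _ {V : Set} {R : V → V → Set} where

  private
    idA : Aut V R
    idA = ↔-id V , λ u v → mk⇔ (λ x → x) (λ x → x)

    compA : Aut V R → Aut V R → Aut V R
    compA (σ , p) (τ , q) = (σ ↔-∘ τ) , λ u v →
      mk⇔ (λ r → Equivalence.to (p _ _) (Equivalence.to (q u v) r))
          (λ r → Equivalence.from (q u v) (Equivalence.from (p _ _) r))

    invA : Aut V R → Aut V R
    invA (σ , p) = ↔-sym σ , λ u v →
      mk⇔ (λ r → Equivalence.from (p (f u) (f v))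
                   (subst₂ R (sym (inv u)) (sym (inv v)) r))
          (λ r → subst₂ R (inv u) (inv v) (Equivalence.to (p (f u) (f v)) r))
      where
        f = Inverse.from σ
        inv : ∀ x → Inverse.to σ (f x) ≡ x
        inv = Inverse.strictlyInverseˡ σ
        subst₂ : (P : V → V → Set) {a b c d : V} → a ≡ b → c ≡ d → P a c → P b d
        subst₂ P refl refl x = x

  AutGroup : RawGroup 0ℓ 0ℓ
  AutGroup = record
    { Carrier = Aut V R
    ; _≈_     = λ σ τ → ∀ x → Inverse.to (proj₁ σ) x ≡ Inverse.to (proj₁ τ) x
    ; _∙_     = compA
    ; ε       = idA
    ; _⁻¹     = invA
    }

AutG : ∀ {n} → SimpleGraph n → RawGroup 0ℓ 0ℓ
AutG {n} G = AutGroup {Fin n} {Adj G}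

AutM : ∀ {n} → SimpleGraph n → RawGroup 0ℓ 0ℓ
AutM G = AutGroup {MVertex G} {MAdj G}

open import Algebra.Morphism.Structures using (module GroupMorphisms)

_≅ᵍ_ : RawGroup 0ℓ 0ℓ → RawGroup 0ℓ 0ℓ → Set
A ≅ᵍ B = ∃[ φ ] GroupMorphisms.IsGroupIsomorphism A B φ

{-# OPTIONS --safe #-}
-- The vertices of G are exactly the simplicial vertices of M(G), i.e. those
-- whose neighbours are pairwise adjacent: the edges at v pairwise share v,
-- whereas the two endpoints of an edge are never adjacent in M(G).
-- Automorphisms preserve simplicial vertices, so every automorphism τ of M(G)
-- restricts to a permutation of V(G). It preserves adjacency of G because two
-- distinct vertices are adjacent iff they have a common neighbour in M(G), and
-- since an edge is the only common neighbour of its endpoints, τ is induced by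
-- its restriction.
module Submission where

open import Defs
open import Data.Nat using (ℕ; _≤_)
open import Data.Bool using (T)
open import Data.Bool.Properties using (T-irrelevant)
open import Data.Fin using (Fin)
open import Data.Fin.Properties using (<-cmp; <-irrelevant; <-asym; <-irrefl)
open import Data.Empty using (⊥-elim)
open import Data.Product using (∃-syntax; _×_; _,_; proj₁; proj₂)
open import Data.Sum using (_⊎_; inj₁; inj₂; swap) renaming (map to map⊎)
open import Data.Sum.Properties using (inj₁-injective; map-cong; map-map)
open import Relation.Binary.Definitions using (tri<; tri≈; tri>)
open import Relation.Binary.PropositionalEquality
open import Relation.Nullary using (¬_)
open import Function using (id; _∘_)
open import Function.Bundles using (_↔_; Inverse; Equivalence; Injection; mk⇔; mk↔ₛ′)
open import Function.Definitions using (Injective)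
open import Function.Properties.Inverse using (↔⇒↣)
open import Algebra.Bundles.Raw using (RawGroup)
open import Algebra.Morphism.Structures using (module GroupMorphisms)

module _ {n : ℕ} (G : SimpleGraph n) where

  Adj-sym : ∀ {u v} → Adj G u v → Adj G v u
  Adj-sym {u} {v} = subst T (adj-sym G u v)

  Adj⇒≢ : ∀ {u v} → Adj G u v → u ≢ v
  Adj⇒≢ {u} p refl = subst T (adj-irrefl G u) p

  edge : ∀ u v → Adj G u v → Edge G
  edge u v p with <-cmp u v
  ... | tri< u<v _ _ = u , v , u<v , p
  ... | tri≈ _ u≡v _ = ⊥-elim (Adj⇒≢ p u≡v)
  ... | tri> _ _ v<u = v , u , v<u , Adj-sym p

  edge-incident : ∀ u v p → Incident G u (edge u v p) × Incident G v (edge u v p)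
  edge-incident u v p with <-cmp u v
  ... | tri< _ _ _   = inj₁ refl , inj₂ refl
  ... | tri≈ _ u≡v _ = ⊥-elim (Adj⇒≢ p u≡v)
  ... | tri> _ _ _   = inj₂ refl , inj₁ refl

  incident-edge : ∀ {u v p w} → Incident G w (edge u v p) → w ≡ u ⊎ w ≡ v
  incident-edge {u} {v} {p} i with <-cmp u v
  ... | tri< _ _ _   = i
  ... | tri≈ _ u≡v _ = ⊥-elim (Adj⇒≢ p u≡v)
  ... | tri> _ _ _   = swap i

  Edge-≡ : ∀ e f → (∀ w → Incident G w e → Incident G w f) → e ≡ f
  Edge-≡ (u , v , u<v , p) (u′ , v′ , u′<v′ , p′) e⊆f
    with e⊆f u (inj₁ refl) | e⊆f v (inj₂ refl)
  ... | inj₁ refl | inj₂ refl =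
    cong₂ (λ u<v p → u , v , u<v , p) (<-irrelevant u<v u′<v′) (T-irrelevant p p′)
  ... | inj₁ refl | inj₁ refl = ⊥-elim (<-irrefl refl u<v)
  ... | inj₂ refl | inj₂ refl = ⊥-elim (<-irrefl refl u<v)
  ... | inj₂ refl | inj₁ refl = ⊥-elim (<-asym u<v u′<v′)

  incident-Adj : ∀ {u v} e → Incident G u e → Incident G v e → u ≢ v → Adj G u v
  incident-Adj _               (inj₁ refl) (inj₁ refl) u≢v = ⊥-elim (u≢v refl)
  incident-Adj (_ , _ , _ , p) (inj₁ refl) (inj₂ refl) _   = p
  incident-Adj (_ , _ , _ , p) (inj₂ refl) (inj₁ refl) _   = Adj-sym p
  incident-Adj _               (inj₂ refl) (inj₂ refl) u≢v = ⊥-elim (u≢v refl)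

record Hom {n m : ℕ} (G : SimpleGraph n) (H : SimpleGraph m) : Set where
  field
    map     : Fin n → Fin m
    map-adj : ∀ {u v} → Adj G u v → Adj H (map u) (map v)

open Hom

idʰ : ∀ {n} {G : SimpleGraph n} → Hom G G
idʰ = record { map = id ; map-adj = id }

_∘ʰ_ : ∀ {n m k} {G : SimpleGraph n} {H : SimpleGraph m} {K : SimpleGraph k} →
       Hom H K → Hom G H → Hom G K
ψ ∘ʰ φ = record { map = map ψ ∘ map φ ; map-adj = λ p → map-adj ψ (map-adj φ p) }

module _ {n m : ℕ} {G : SimpleGraph n} {H : SimpleGraph m} where

  mapEdge : Hom G H → Edge G → Edge H
  mapEdge φ (u , v , _ , p) = edge H (map φ u) (map φ v) (map-adj φ p)

  mapEdge-incident : ∀ φ e {x} → Incident G x e → Incident H (map φ x) (mapEdge φ e)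
  mapEdge-incident φ (_ , _ , _ , p) (inj₁ refl) = proj₁ (edge-incident H _ _ (map-adj φ p))
  mapEdge-incident φ (_ , _ , _ , p) (inj₂ refl) = proj₂ (edge-incident H _ _ (map-adj φ p))

  incident-mapEdge : ∀ φ e {y} → Incident H y (mapEdge φ e) →
                     ∃[ x ] Incident G x e × y ≡ map φ x
  incident-mapEdge φ (u , v , _ , _) i with incident-edge H i
  ... | inj₁ y≡φu = u , inj₁ refl , y≡φu
  ... | inj₂ y≡φv = v , inj₂ refl , y≡φv

  mapEdge-unique : ∀ φ e f → (∀ x → Incident G x e → Incident H (map φ x) f) →
                   mapEdge φ e ≡ f
  mapEdge-unique φ e f φe⊆f = Edge-≡ H _ _ λ _ → incident-f ∘ incident-mapEdge φ e
    where
      incident-f : ∀ {y} → ∃[ x ] Incident G x e × y ≡ map φ x → Incident H y f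
      incident-f (x , x∈e , refl) = φe⊆f x x∈e

  mapEdge-cong : ∀ φ ψ → map φ ≗ map ψ → mapEdge φ ≗ mapEdge ψ
  mapEdge-cong φ ψ φ≗ψ e = mapEdge-unique φ e _ λ x x∈e →
    subst (λ y → Incident H y (mapEdge ψ e)) (sym (φ≗ψ x)) (mapEdge-incident ψ e x∈e)

  mapEdge-injective : ∀ φ → Injective _≡_ _≡_ (map φ) → Injective _≡_ _≡_ (mapEdge φ)
  mapEdge-injective φ φ-inj {e} {e′} φe≡φe′ = Edge-≡ G e e′ λ x x∈e →
    incident-e′ (incident-mapEdge φ e′
      (subst (Incident H (map φ x)) φe≡φe′ (mapEdge-incident φ e x∈e)))
    where
      incident-e′ : ∀ {x} → ∃[ x′ ] Incident G x′ e′ × map φ x ≡ map φ x′ → Incident G x e′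
      incident-e′ (x′ , x′∈e′ , φx≡φx′) =
        subst (λ y → Incident G y e′) (sym (φ-inj φx≡φx′)) x′∈e′

mapEdge-id : ∀ {n} {G : SimpleGraph n} → mapEdge (idʰ {G = G}) ≗ id
mapEdge-id e = mapEdge-unique idʰ e e λ _ x∈e → x∈e

mapEdge-∘ : ∀ {n m k} {G : SimpleGraph n} {H : SimpleGraph m} {K : SimpleGraph k}
            (ψ : Hom H K) (φ : Hom G H) → mapEdge (ψ ∘ʰ φ) ≗ mapEdge ψ ∘ mapEdge φ
mapEdge-∘ ψ φ e = mapEdge-unique (ψ ∘ʰ φ) e _ λ _ x∈e →
  mapEdge-incident ψ (mapEdge φ e) (mapEdge-incident φ e x∈e)

module _ {n m : ℕ} {G : SimpleGraph n} {H : SimpleGraph m} where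

  mapM : Hom G H → MVertex G → MVertex H
  mapM φ = map⊎ (map φ) (mapEdge φ)

  mapM-cong : ∀ φ ψ → map φ ≗ map ψ → mapM φ ≗ mapM ψ
  mapM-cong φ ψ φ≗ψ = map-cong φ≗ψ (mapEdge-cong φ ψ φ≗ψ)

  mapM-MAdj : ∀ φ → Injective _≡_ _≡_ (map φ) →
              ∀ x y → MAdj G x y → MAdj H (mapM φ x) (mapM φ y)
  mapM-MAdj φ _ (inj₁ v) (inj₂ e) v∈e = mapEdge-incident φ e v∈e
  mapM-MAdj φ _ (inj₂ e) (inj₁ v) v∈e = mapEdge-incident φ e v∈e
  mapM-MAdj φ φ-inj (inj₂ e) (inj₂ f) (e≢f , w , w∈e , w∈f) =
    e≢f ∘ mapEdge-injective φ φ-inj ,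
    map φ w , mapEdge-incident φ e w∈e , mapEdge-incident φ f w∈f

  common-neighbour≡mapEdge : ∀ (φ : Hom G H) e y →
                             (∀ x → Incident G x e → MAdj H (inj₁ (map φ x)) y) →
                             y ≡ inj₂ (mapEdge φ e)
  common-neighbour≡mapEdge φ (u , _) (inj₁ _) adj = ⊥-elim (adj u (inj₁ refl))
  common-neighbour≡mapEdge φ e (inj₂ f) adj = cong inj₂ (sym (mapEdge-unique φ e f adj))

mapM-id : ∀ {n} {G : SimpleGraph n} → mapM (idʰ {G = G}) ≗ id
mapM-id (inj₁ _) = refl
mapM-id (inj₂ e) = cong inj₂ (mapEdge-id e)

mapM-∘ : ∀ {n m k} {G : SimpleGraph n} {H : SimpleGraph m} {K : SimpleGraph k}
         (ψ : Hom H K) (φ : Hom G H) → mapM (ψ ∘ʰ φ) ≗ mapM ψ ∘ mapM φ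
mapM-∘ ψ φ x = trans (map-cong (λ _ → refl) (mapEdge-∘ ψ φ) x) (sym (map-map x))

mapM-inverse : ∀ {n m} {G : SimpleGraph n} {H : SimpleGraph m} (ψ : Hom H G) (φ : Hom G H) →
               map ψ ∘ map φ ≗ id → mapM ψ ∘ mapM φ ≗ id
mapM-inverse ψ φ ψφ≗id x = begin
  mapM ψ (mapM φ x)  ≡⟨ mapM-∘ ψ φ x ⟨
  mapM (ψ ∘ʰ φ) x    ≡⟨ mapM-cong (ψ ∘ʰ φ) idʰ ψφ≗id x ⟩
  mapM idʰ x         ≡⟨ mapM-id x ⟩
  x                  ∎
  where open ≡-Reasoning

Simplicial : {V : Set} → (V → V → Set) → V → Set
Simplicial R x = ∀ {y z} → R x y → R x z → y ≢ z → R y z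

module _ {n : ℕ} (G : SimpleGraph n) where

  vertex-simplicial : ∀ v → Simplicial (MAdj G) (inj₁ v)
  vertex-simplicial v {inj₂ e} {inj₂ f} v∈e v∈f e≢f = e≢f ∘ cong inj₂ , v , v∈e , v∈f

  edge-not-simplicial : ∀ e → ¬ Simplicial (MAdj G) (inj₂ e)
  edge-not-simplicial (u , v , u<v , _) simplicial =
    simplicial (inj₁ refl) (inj₂ refl) (λ u≡v → <-irrefl (inj₁-injective u≡v) u<v)

  simplicial⇒vertex : ∀ {x} → Simplicial (MAdj G) x → ∃[ v ] x ≡ inj₁ v
  simplicial⇒vertex {inj₁ v} _          = v , refl
  simplicial⇒vertex {inj₂ e} simplicial = ⊥-elim (edge-not-simplicial e simplicial)

  MAdj-common-neighbour⇒Adj : ∀ {u v} y → MAdj G (inj₁ u) y → MAdj G (inj₁ v) y →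
                              u ≢ v → Adj G u v
  MAdj-common-neighbour⇒Adj (inj₂ e) = incident-Adj G e

module _ {V : Set} {R : V → V → Set} where

  mkAut : (σ : V ↔ V) → (∀ {u v} → R u v → R (Inverse.to σ u) (Inverse.to σ v)) →
          (∀ {u v} → R u v → R (Inverse.from σ u) (Inverse.from σ v)) → Aut V R
  mkAut σ to-adj from-adj = σ , λ u v → mk⇔ to-adj
    (λ r → subst₂ R (strictlyInverseʳ u) (strictlyInverseʳ v) (from-adj r))
    where open Inverse σ

  Aut-injective : (σ : Aut V R) → Injective _≡_ _≡_ (Inverse.to (proj₁ σ))
  Aut-injective σ = Injection.injective (↔⇒↣ (proj₁ σ))

  Aut-simplicial : (τ : Aut V R) → ∀ {x} → Simplicial R x → Simplicial R (Inverse.to (proj₁ τ) x)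
  Aut-simplicial (τ , τ-adj) {x} simplicial {y} {z} r₁ r₂ y≢z =
    subst₂ R (strictlyInverseˡ y) (strictlyInverseˡ z)
      (Equivalence.to (τ-adj _ _) (simplicial (pull r₁) (pull r₂) (y≢z ∘ from-injective)))
    where
      open Inverse τ
      pull : ∀ {y} → R (to x) y → R x (from y)
      pull {y} r =
        Equivalence.from (τ-adj x (from y)) (subst (R (to x)) (sym (strictlyInverseˡ y)) r)
      from-injective : ∀ {y z} → from y ≡ from z → y ≡ z
      from-injective {y} {z} eq =
        trans (sym (strictlyInverseˡ y)) (trans (cong to eq) (strictlyInverseˡ z))

module _ {n : ℕ} (G : SimpleGraph n) where

  open RawGroup (AutG G) using () renaming (_⁻¹ to _⁻¹ᴳ)
  open RawGroup (AutM G) using () renaming (_⁻¹ to _⁻¹ᴹ)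

  toʰ : Aut (Fin n) (Adj G) → Hom G G
  toʰ σ = record { map = Inverse.to (proj₁ σ) ; map-adj = Equivalence.to (proj₂ σ _ _) }

  induced : Aut (Fin n) (Adj G) → Aut (MVertex G) (MAdj G)
  induced σ = mkAut
    (mk↔ₛ′ (mapM φ) (mapM φ⁻¹)
      (mapM-inverse φ φ⁻¹ strictlyInverseˡ) (mapM-inverse φ⁻¹ φ strictlyInverseʳ))
    (mapM-MAdj φ (Aut-injective σ) _ _) (mapM-MAdj φ⁻¹ (Aut-injective (σ ⁻¹ᴳ)) _ _)
    where
      open Inverse (proj₁ σ)
      φ = toʰ σ
      φ⁻¹ = toʰ (σ ⁻¹ᴳ)

  module Restriction (τ : Aut (MVertex G) (MAdj G)) where

    open Inverse (proj₁ τ) using (to)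

    vertex-image : ∀ v → ∃[ w ] to (inj₁ v) ≡ inj₁ w
    vertex-image v = simplicial⇒vertex G (Aut-simplicial τ (vertex-simplicial G v))

    restrict : Fin n → Fin n
    restrict = proj₁ ∘ vertex-image

    restrict-spec : ∀ v → to (inj₁ v) ≡ inj₁ (restrict v)
    restrict-spec = proj₂ ∘ vertex-image

    restrict-injective : Injective _≡_ _≡_ restrict
    restrict-injective {u} {v} eq = inj₁-injective (Aut-injective τ
      (trans (restrict-spec u) (trans (cong inj₁ eq) (sym (restrict-spec v)))))

    restrict-neighbour : ∀ {u} e → Incident G u e → MAdj G (inj₁ (restrict u)) (to (inj₂ e))
    restrict-neighbour e u∈e =
      subst (λ x → MAdj G x (to (inj₂ e))) (restrict-spec _) (Equivalence.to (proj₂ τ _ _) u∈e)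

    restrict-adj : ∀ {u v} → Adj G u v → Adj G (restrict u) (restrict v)
    restrict-adj {u} {v} p = MAdj-common-neighbour⇒Adj G (to (inj₂ e))
      (restrict-neighbour e (proj₁ (edge-incident G u v p)))
      (restrict-neighbour e (proj₂ (edge-incident G u v p)))
      (Adj⇒≢ G p ∘ restrict-injective)
      where e = edge G u v p

    restrictʰ : Hom G G
    restrictʰ = record { map = restrict ; map-adj = restrict-adj }

    mapM-restrict : mapM restrictʰ ≗ to
    mapM-restrict (inj₁ v) = sym (restrict-spec v)
    mapM-restrict (inj₂ e) =
      sym (common-neighbour≡mapEdge restrictʰ e (to (inj₂ e)) λ _ → restrict-neighbour e)

  open Restriction using (restrict; restrict-spec; restrict-adj; restrictʰ; mapM-restrict)

  restrict-inverse : ∀ τ τ′ → Inverse.to (proj₁ τ) ∘ Inverse.to (proj₁ τ′) ≗ id →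
                     restrict τ ∘ restrict τ′ ≗ id
  restrict-inverse τ τ′ ττ′≗id v = inj₁-injective (begin
    inj₁ (restrict τ (restrict τ′ v))  ≡⟨ restrict-spec τ _ ⟨
    to τ (inj₁ (restrict τ′ v))        ≡⟨ cong (to τ) (restrict-spec τ′ v) ⟨
    to τ (to τ′ (inj₁ v))              ≡⟨ ττ′≗id (inj₁ v) ⟩
    inj₁ v                             ∎)
    where
      open ≡-Reasoning
      to = Inverse.to ∘ proj₁

  restrictAut : Aut (MVertex G) (MAdj G) → Aut (Fin n) (Adj G)
  restrictAut τ = mkAut
    (mk↔ₛ′ (restrict τ) (restrict (τ ⁻¹ᴹ))
      (restrict-inverse τ (τ ⁻¹ᴹ) (Inverse.strictlyInverseˡ (proj₁ τ)))
      (restrict-inverse (τ ⁻¹ᴹ) τ (Inverse.strictlyInverseʳ (proj₁ τ))))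
    (restrict-adj τ) (restrict-adj (τ ⁻¹ᴹ))

  open GroupMorphisms (AutG G) (AutM G)

  induced-isGroupIsomorphism : IsGroupIsomorphism induced
  induced-isGroupIsomorphism = record
    { isGroupMonomorphism = record
      { isGroupHomomorphism = record
        { isMonoidHomomorphism = record
          { isMagmaHomomorphism = record
            { isRelHomomorphism = record { cong = λ {σ} {σ′} → mapM-cong (toʰ σ) (toʰ σ′) }
            ; homo = λ σ σ′ → mapM-∘ (toʰ σ) (toʰ σ′) }
          ; ε-homo = mapM-id }
        ; ⁻¹-homo = λ _ _ → refl }
      ; injective = λ induced-σ≈σ′ v → inj₁-injective (induced-σ≈σ′ (inj₁ v)) }
    ; surjective = λ τ → restrictAut τ , λ {σ} σ≈restrict x →
        trans (mapM-cong (toʰ σ) (restrictʰ τ) σ≈restrict x) (mapM-restrict τ x) }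

lemma2p10 : (n : ℕ) → 3 ≤ n → (G : SimpleGraph n) → Connected G →
    AutG G ≅ᵍ AutM G
lemma2p10 n _ G _ = induced G , induced-isGroupIsomorphism G
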